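{- Let $G$ be any finite simple undirected graph, viewed as a position of the Forbidden Leaf Variant of the Mixed Deletion Game. If Left has a legal move in $G$, then Right also has a legal move in $G$. (Equivalently, there is no graph position which contains a move for Left and no move for Right.)
   Context: The Classic Variant of the Mixed Deletion Game is a two-player combinatorial game between Left and Right played on a finite simple undirected graph; players alternate turns. On her turn Left deletes one vertex together with all edges incident to it; on his turn Right deletes one edge. The game ends when a deletion creates an isolated vertex (a vertex of degree $0$), and the player whose deletion created an isolated vertex loses; thus a legal move is a deletion which does not create an isolated vertex, and a player with no legal move loses. The Forbidden Leaf Variant has the same rules with the additional restriction that Left may not delete a leaf (a vertex of degree $1$). -}

module Defs where

open import Data.Nat using (ℕ; zero; suc)
open import Data.Bool using (Bool; true; false; if_then_else_; _∧_; _∨_; not)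
open import Data.Fin using (Fin; punchIn; _≟_)
open import Data.List using (List; map; allFin)
open import Data.Nat.ListAction using (sum)
open import Data.Product using (Σ; _×_; ∃-syntax)
open import Data.Empty using (⊥)
open import Relation.Nullary using (¬_; ⌊_⌋)
open import Relation.Binary.PropositionalEquality using (_≡_)

Adj : ℕ → Set
Adj n = Fin n → Fin n → Bool

record IsSimple {n : ℕ} (adj : Adj n) : Set where
  field
    symmetric   : ∀ u v → adj u v ≡ adj v u
    irreflexive : ∀ v → adj v v ≡ false

degree : {n : ℕ} → Adj n → Fin n → ℕ
degree {n} adj u = sum (map (λ w → if adj u w then 1 else 0) (allFin n))

Isolated : {n : ℕ} → Adj n → Fin n → Set
Isolated adj u = degree adj u ≡ 0

Leaf : {n : ℕ} → Adj n → Fin n → Set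
Leaf adj u = degree adj u ≡ 1

NoIsolated : {n : ℕ} → Adj n → Set
NoIsolated {n} adj = ∀ (u : Fin n) → ¬ Isolated adj u

deleteVertex : {m : ℕ} → Adj (suc m) → Fin (suc m) → Adj m
deleteVertex adj v i j = adj (punchIn v i) (punchIn v j)

deleteEdge : {n : ℕ} → Adj n → Fin n → Fin n → Adj n
deleteEdge adj u w i j =
  adj i j ∧ not ((⌊ i ≟ u ⌋ ∧ ⌊ j ≟ w ⌋) ∨ (⌊ i ≟ w ⌋ ∧ ⌊ j ≟ u ⌋))

-- Forbidden Leaf Variant: Left deletes a non-leaf vertex, and the move is legal
-- iff it creates no isolated vertex.
LeftHasMove : {n : ℕ} → Adj n → Set
LeftHasMove {zero}  adj = ⊥
LeftHasMove {suc m} adj =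
  ∃[ v ] (¬ Leaf adj v × NoIsolated (deleteVertex adj v))

RightHasMove : {n : ℕ} → Adj n → Set
RightHasMove {n} adj =
  Σ (Fin n) λ u → Σ (Fin n) λ w → (adj u w ≡ true) × NoIsolated (deleteEdge adj u w)

module Submission where

open import Defs
open import Data.Nat using (ℕ; zero; suc)
open import Data.Bool using (Bool; true; false; if_then_else_; _∧_)
open import Data.Bool.Properties using (¬-not)
import Data.Bool as Bool
open import Data.Fin using (Fin; punchIn; punchOut; _≟_)
open import Data.Fin.Properties using (punchIn-punchOut; punchInᵢ≢i; any?)
open import Data.List using (List; []; _∷_; map; allFin)
open import Data.Nat.ListAction using (sum)
open import Data.Product using (_×_; _,_; ∃; proj₁; proj₂)
open import Data.Empty using (⊥-elim)
open import Function using (_∘_)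
open import Relation.Nullary using (¬_; ⌊_⌋; Dec; yes; no)
open import Relation.Nullary.Decidable using (_×-dec_; ¬?)
open import Relation.Binary.PropositionalEquality using (_≡_; _≢_; refl; sym; trans; cong; subst)
open import Data.List.Membership.Propositional using (_∈_)
open import Data.List.Membership.Propositional.Properties using (∈-allFin)
open import Data.List.Relation.Unary.Any using (here; there)
open import Data.List.Relation.Unary.All using (All; []; _∷_)
import Data.List.Relation.Unary.All as All
open import Data.List.Relation.Unary.AllPairs using (_∷_)
open import Data.List.Relation.Unary.Unique.Propositional using (Unique)
open import Data.List.Relation.Unary.Unique.Propositional.Properties using (allFin⁺)

-- Left deletes a vertex v, which is not a leaf and, not being isolated, has degree ≥ 2.
-- Right answers by deleting an edge va. Then v keeps a second neighbour b ≠ a; a keeps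
-- a neighbour c ≠ v, because a is not isolated in G - v; every other vertex keeps all
-- its edges. So the deletion of va isolates no vertex.

count : {A : Set} → (A → Bool) → List A → ℕ
count f xs = sum (map (λ x → if f x then 1 else 0) xs)

count≢0⇒∃ : {A : Set} (f : A → Bool) (xs : List A) → count f xs ≢ 0 → ∃ λ x → f x ≡ true
count≢0⇒∃ f []       ≢0 = ⊥-elim (≢0 refl)
count≢0⇒∃ f (x ∷ xs) ≢0 with f x in fx
... | true  = x , fx
... | false = count≢0⇒∃ f xs ≢0

∈⇒count≢0 : {A : Set} (f : A → Bool) {xs : List A} {y : A} → y ∈ xs → f y ≡ true → count f xs ≢ 0
∈⇒count≢0 f {xs = x ∷ _} (here refl) fy rewrite fy = λ ()
∈⇒count≢0 f {xs = x ∷ _} (there y∈) fy with f x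
... | true  = λ ()
... | false = ∈⇒count≢0 f y∈ fy

count≡0 : {A : Set} (f : A → Bool) {xs : List A} → All (λ x → f x ≡ false) xs → count f xs ≡ 0
count≡0 f []         = refl
count≡0 f (fx ∷ fxs) rewrite fx = count≡0 f fxs

count≡1 : {A : Set} (f : A → Bool) {xs : List A} {a : A} → Unique xs → a ∈ xs → f a ≡ true →
          (∀ x → f x ≡ true → x ≡ a) → count f xs ≡ 1
count≡1 f {a = a} (x∉xs ∷ _) (here refl) fa only rewrite fa =
  cong suc (count≡0 f (All.map false-off x∉xs))
  where
  false-off : ∀ {y} → a ≢ y → f y ≡ false
  false-off a≢y = ¬-not (a≢y ∘ sym ∘ only _)
count≡1 f {x ∷ _} (x∉xs ∷ unique) (there a∈) fa only
  rewrite ¬-not {f x} (All.lookup x∉xs a∈ ∘ only x) = count≡1 f unique a∈ fa only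

neighbour : ∀ {n} (adj : Adj n) {x} → ¬ Isolated adj x → ∃ λ y → adj x y ≡ true
neighbour {n} adj {x} = count≢0⇒∃ (adj x) (allFin n)

neighbour⇒¬isolated : ∀ {n} (adj : Adj n) {x y} → adj x y ≡ true → ¬ Isolated adj x
neighbour⇒¬isolated adj {x} {y} = ∈⇒count≢0 (adj x) (∈-allFin y)

adjacent⇒≢ : ∀ {n} {adj : Adj n} → IsSimple adj → ∀ {u w} → adj u w ≡ true → u ≢ w
adjacent⇒≢ simple {u} uu refl with trans (sym uu) (IsSimple.irreflexive simple u)
... | ()

¬leaf⇒anotherNeighbour : ∀ {n} (adj : Adj n) {v a} → ¬ Leaf adj v → adj v a ≡ true →
                          ∃ λ b → adj v b ≡ true × b ≢ a
¬leaf⇒anotherNeighbour {n} adj {v} {a} nonleaf va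
  with any? (λ b → (adj v b Bool.≟ true) ×-dec ¬? (b ≟ a))
... | yes b = b
... | no ∄b = ⊥-elim (nonleaf (count≡1 (adj v) (allFin⁺ n) (∈-allFin a) va onlyA))
  where
  onlyA : ∀ z → adj v z ≡ true → z ≡ a
  onlyA z vz with z ≟ a
  ... | yes z≡a = z≡a
  ... | no z≢a  = ⊥-elim (∄b (z , vz , z≢a))

neighbourAvoiding : ∀ {m} (adj : Adj (suc m)) {v a} (v≢a : v ≢ a) →
                    NoIsolated (deleteVertex adj v) → ∃ λ c → adj a c ≡ true × c ≢ v
neighbourAvoiding adj {v} v≢a noIso
  with neighbour (deleteVertex adj v) (noIso (punchOut v≢a))
... | j , aj = punchIn v j , subst (λ a → adj a (punchIn v j) ≡ true) (punchIn-punchOut v≢a) aj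
             , punchInᵢ≢i v j

≟∧≟≡false : ∀ {n} {i j k l : Fin n} → ¬ (i ≡ k × j ≡ l) → (⌊ i ≟ k ⌋ ∧ ⌊ j ≟ l ⌋) ≡ false
≟∧≟≡false {i = i} {j} {k} {l} ¬ij with i ≟ k | j ≟ l
... | yes i≡k | yes j≡l = ⊥-elim (¬ij (i≡k , j≡l))
... | yes _   | no _    = refl
... | no _    | _       = refl

deleteEdge-preserves : ∀ {n} (adj : Adj n) {u w x y} → adj x y ≡ true →
                       ¬ (x ≡ u × y ≡ w) → ¬ (x ≡ w × y ≡ u) → deleteEdge adj u w x y ≡ true
deleteEdge-preserves adj xy ¬uw ¬wu rewrite xy | ≟∧≟≡false ¬uw | ≟∧≟≡false ¬wu = refl

deleteEdge-noIsolated : ∀ {n} {adj : Adj n} → NoIsolated adj → ∀ {u w} → u ≢ w →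
                        (∃ λ b → adj u b ≡ true × b ≢ w) →
                        (∃ λ c → adj w c ≡ true × c ≢ u) →
                        NoIsolated (deleteEdge adj u w)
deleteEdge-noIsolated {adj = adj} noIso {u} {w} u≢w (b , ub , b≢w) (c , wc , c≢u) x =
  byCases (x ≟ u) (x ≟ w)
  where
  kept : ∀ {x y} → adj x y ≡ true → ¬ (x ≡ u × y ≡ w) → ¬ (x ≡ w × y ≡ u) →
         ¬ Isolated (deleteEdge adj u w) x
  kept xy ¬uw ¬wu = neighbour⇒¬isolated (deleteEdge adj u w) (deleteEdge-preserves adj xy ¬uw ¬wu)

  byCases : Dec (x ≡ u) → Dec (x ≡ w) → ¬ Isolated (deleteEdge adj u w) x
  byCases (yes refl) _ = kept ub (b≢w ∘ proj₂) (u≢w ∘ proj₁)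
  byCases (no _) (yes refl) = kept wc (u≢w ∘ sym ∘ proj₁) (c≢u ∘ proj₂)
  byCases (no x≢u) (no x≢w) =
    let y , xy = neighbour adj (noIso x) in kept xy (x≢u ∘ proj₁) (x≢w ∘ proj₁)

proposition3p9 : (n : ℕ) (adj : Adj n) → IsSimple adj → NoIsolated adj →
                 LeftHasMove adj → RightHasMove adj
proposition3p9 zero    adj simple noIso ()
proposition3p9 (suc m) adj simple noIso (v , nonleaf , noIso-v) with neighbour adj (noIso v)
... | a , va = v , a , va , deleteEdge-noIsolated noIso v≢a
                              (¬leaf⇒anotherNeighbour adj nonleaf va) (neighbourAvoiding adj v≢a noIso-v)
  where
  v≢a : v ≢ a
  v≢a = adjacent⇒≢ simple va
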